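{- For every finite poset $P$ and every $n$, $\mathrm{La}^*_R(n,P)=\mathrm{La}^*(n,M(P))$.
   Context: All posets are finite. A subset of a poset (or subfamily of a family of sets ordered by inclusion) is a copy of $P$ if with the induced order it is isomorphic to $P$. A family is $P$-free if it contains no copy of $P$, and for a set $\mathcal{P}$ of posets it is $\mathcal{P}$-free if it is $P$-free for all $P\in\mathcal{P}$. $\mathrm{La}^*(n,\mathcal{P})$ is the maximum size of a $\mathcal{P}$-free family $\mathcal{F}\subseteq 2^{[n]}$. A coloring of a poset is proper if comparable distinct elements get distinct colors; a copy is rainbow if its elements receive pairwise distinct colors. $\mathrm{La}^*_R(n,P)$ is the maximum size of a family $\mathcal{F}\subseteq 2^{[n]}$ admitting a proper coloring with no rainbow copy of $P$. A poset $Q$ rainbow forces $P$ if every proper coloring of $Q$ admits a rainbow copy of $P$; $M(P)$ is the set of posets $Q$ that rainbow force $P$ but such that $Q\setminus\{q\}$ does not rainbow force $P$ for any $q\in Q$. -}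

module Defs where

open import Data.Nat using (ℕ; zero; suc; _≤_)
open import Data.Bool using (Bool; T)
open import Data.Fin using (Fin; punchIn)
open import Data.Fin.Properties using (punchIn-injective)
open import Data.Fin.Subset using (Subset; _⊆_)
open import Data.Product using (Σ; _×_; _,_)
open import Relation.Nullary using (¬_)
open import Relation.Binary.PropositionalEquality using (_≡_; _≢_)
open import Function.Base using (_∘_)
open import Function.Definitions using (Injective)
open import Function.Bundles using (_⇔_)

record FinPoset : Set where
  constructor mkPoset
  field
    size    : ℕ
    leq     : Fin size → Fin size → Bool
    reflx   : ∀ x → T (leq x x)
    antisym : ∀ x y → T (leq x y) → T (leq y x) → x ≡ y
    trans   : ∀ x y z → T (leq x y) → T (leq y z) → T (leq x z)

open FinPoset public

Le : (Q : FinPoset) → Fin (size Q) → Fin (size Q) → Set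
Le Q x y = T (leq Q x y)

IsCopy : (P : FinPoset) {m : ℕ} (R : Fin m → Fin m → Set) → (Fin (size P) → Fin m) → Set
IsCopy P R g = Injective _≡_ _≡_ g × (∀ x y → (Le P x y ⇔ R (g x) (g y)))

HasCopy : (P : FinPoset) {m : ℕ} (R : Fin m → Fin m → Set) → Set
HasCopy P {m} R = Σ (Fin (size P) → Fin m) λ g → IsCopy P R g

Proper : {m : ℕ} (R : Fin m → Fin m → Set) → (Fin m → ℕ) → Set
Proper R c = ∀ i j → i ≢ j → R i j → c i ≢ c j

HasRainbowCopy : (P : FinPoset) {m : ℕ} (R : Fin m → Fin m → Set) → (Fin m → ℕ) → Set
HasRainbowCopy P {m} R c =
  Σ (Fin (size P) → Fin m) λ g → IsCopy P R g × Injective _≡_ _≡_ (c ∘ g)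

RainbowForces : FinPoset → FinPoset → Set
RainbowForces Q P = ∀ (c : Fin (size Q) → ℕ) → Proper (Le Q) c → HasRainbowCopy P (Le Q) c

private
  delete' : (k : ℕ) (R : Fin (suc k) → Fin (suc k) → Bool)
            → (∀ x → T (R x x))
            → (∀ x y → T (R x y) → T (R y x) → x ≡ y)
            → (∀ x y z → T (R x y) → T (R y z) → T (R x z))
            → Fin (suc k) → FinPoset
  delete' k R r a t q = mkPoset k
    (λ x y → R (punchIn q x) (punchIn q y))
    (λ x → r (punchIn q x))
    (λ x y p p' → punchIn-injective q x y (a _ _ p p'))
    (λ x y z → t (punchIn q x) (punchIn q y) (punchIn q z))

delete : (Q : FinPoset) → Fin (size Q) → FinPoset
delete (mkPoset (suc k) R r a t) q = delete' k R r a t q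

InM : FinPoset → FinPoset → Set
InM P Q = RainbowForces Q P × (∀ (q : Fin (size Q)) → ¬ RainbowForces (delete Q q) P)

record Family (n : ℕ) : Set where
  constructor mkFamily
  field
    card    : ℕ
    member  : Fin card → Subset n
    distinct : Injective _≡_ _≡_ member

open Family public

Incl : {n : ℕ} (F : Family n) → Fin (card F) → Fin (card F) → Set
Incl F i j = member F i ⊆ member F j

Free : {n : ℕ} → (FinPoset → Set) → Family n → Set
Free 𝒫 F = ∀ (Q : FinPoset) → 𝒫 Q → ¬ HasCopy Q (Incl F)

RainbowFree : {n : ℕ} → FinPoset → Family n → Set
RainbowFree P F = Σ (Fin (card F) → ℕ) λ c → Proper (Incl F) c × ¬ HasRainbowCopy P (Incl F) c

IsMaxSize : (n : ℕ) → (Family n → Set) → ℕ → Set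
IsMaxSize n Good m =
  (Σ (Family n) λ F → Good F × card F ≡ m) × (∀ (F : Family n) → Good F → card F ≤ m)

IsLa : ℕ → (FinPoset → Set) → ℕ → Set
IsLa n 𝒫 m = IsMaxSize n (Free 𝒫) m

IsLaR : ℕ → FinPoset → ℕ → Set
IsLaR n P m = IsMaxSize n (RainbowFree P) m

{-# OPTIONS --safe #-}
-- A proper colouring of a family restricts to a proper colouring of every copy of a
-- poset Q inside it, so if Q rainbow forces P then every proper colouring of the
-- family has a rainbow P.  Hence a family with a P-rainbow-avoiding colouring contains
-- no member of M(P).  Conversely, if no avoiding colouring exists, the family itself
-- rainbow forces P, and deleting elements for as long as forcing survives ends at a
-- member of M(P) embedded in the family.
--
-- The case distinction is constructive because the existence of an avoiding colouring
-- of a k-element poset is decidable: a colouring matters only through which elements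
-- share a colour, so it suffices to search the finitely many colourings Fin k → Fin k.
module Submission where

open import Defs hiding (trans)
open import Data.Nat using (ℕ; suc; _<_)
open import Data.Nat.Properties using (≤-refl) renaming (_≟_ to _≟ℕ_)
open import Data.Nat.Induction using (<-wellFounded)
open import Data.Bool using (T)
open import Data.Empty using (⊥-elim)
open import Data.Fin using (Fin; toℕ; punchIn; finToFun; funToFin)
open import Data.Fin.Properties
  using (any?; all?; toℕ-injective; punchIn-injective; finToFun-funToFin)
  renaming (_≟_ to _≟Fin_)
open import Data.Fin.Subset using (Subset; _⊆_)
open import Data.Fin.Subset.Properties using (_⊆?_; ⊆-refl; ⊆-trans; ⊆-antisym)
open import Data.Product using (∃; _×_; _,_)
open import Function.Base using (_∘_; id)
open import Function.Bundles using (_⇔_; mk⇔; Equivalence)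
open import Function.Definitions using (Injective)
open import Induction.WellFounded using (Acc; acc)
open import Level using (0ℓ)
open import Relation.Binary.Core using (Rel; _⇒_)
open import Relation.Binary.Definitions using (Decidable; DecidableEquality)
open import Relation.Binary.PropositionalEquality
  using (_≡_; refl; sym; trans; cong; subst₂; _≗_)
open import Relation.Nullary using (¬_; Dec; yes; no)
open import Relation.Nullary.Decidable
  using (_×-dec_; _→-dec_; ¬?; map′; T?; toWitness; fromWitness; ⌊_⌋)

open Equivalence using (to; from)

private
  variable
    a b k m n : ℕ
    A B : Set

any?-function : {Pr : (Fin a → Fin b) → Set} → (∀ f → Dec (Pr f)) →
                (∀ {f g} → f ≗ g → Pr f → Pr g) → Dec (∃ Pr)
any?-function Pr? resp = map′
  (λ (i , p) → finToFun i , p)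
  (λ (f , p) → funToFin f , resp (sym ∘ finToFun-funToFin f) p)
  (any? (Pr? ∘ finToFun))

_⇔-dec_ : Dec A → Dec B → Dec (A ⇔ B)
a? ⇔-dec b? = map′ (λ (f , g) → mk⇔ f g) (λ e → to e , from e)
                   ((a? →-dec b?) ×-dec (b? →-dec a?))

injective? : DecidableEquality A → (f : Fin n → A) → Dec (Injective _≡_ _≡_ f)
injective? _≟_ f = map′ (λ inj {x} {y} → inj x y) (λ inj x y → inj)
  (all? λ x → all? λ y → (f x ≟ f y) →-dec (x ≟Fin y))

injective-resp-≗ : {f g : Fin n → A} → f ≗ g → Injective _≡_ _≡_ f → Injective _≡_ _≡_ g
injective-resp-≗ f≗g inj {x} {y} gx≡gy = inj (trans (f≗g x) (trans gx≡gy (sym (f≗g y))))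

Le? : (Q : FinPoset) → Decidable (Le Q)
Le? Q x y = T? (leq Q x y)

module _ (P : FinPoset) {R : Rel (Fin m) 0ℓ} {g : Fin (size P) → Fin m} where

  isCopy? : Decidable R → Dec (IsCopy P R g)
  isCopy? R? = injective? _≟Fin_ g ×-dec
    all? λ x → all? λ y → Le? P x y ⇔-dec R? (g x) (g y)

  isCopy-cong : ∀ {S} → R ⇒ S → S ⇒ R → IsCopy P R g → IsCopy P S g
  isCopy-cong R⇒S S⇒R (inj , iso) =
    inj , λ x y → mk⇔ (R⇒S ∘ to (iso x y)) (from (iso x y) ∘ S⇒R)

  isCopy-resp-≗ : ∀ {h} → g ≗ h → IsCopy P R g → IsCopy P R h
  isCopy-resp-≗ g≗h (inj , iso) = injective-resp-≗ g≗h inj , λ x y → mk⇔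
    (subst₂ R (g≗h x) (g≗h y) ∘ to (iso x y))
    (from (iso x y) ∘ subst₂ R (sym (g≗h x)) (sym (g≗h y)))

isCopy-∘ : ∀ {P Q} {R : Rel (Fin m) 0ℓ} {h g} →
           IsCopy Q R h → IsCopy P (Le Q) g → IsCopy P R (h ∘ g)
isCopy-∘ (h-inj , h-iso) (g-inj , g-iso) =
  g-inj ∘ h-inj ,
  λ x y → mk⇔ (to (h-iso _ _) ∘ to (g-iso x y)) (from (g-iso x y) ∘ from (h-iso _ _))

isCopy-id : ∀ Q → IsCopy Q (Le Q) id
isCopy-id Q = id , λ x y → mk⇔ id id

delete-hasCopy : ∀ Q q → HasCopy (delete Q q) (Le Q)
delete-hasCopy (mkPoset (suc k) _ _ _ _) q =
  punchIn q , punchIn-injective q _ _ , λ x y → mk⇔ id id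

size-delete : ∀ Q q → size (delete Q q) < size Q
size-delete (mkPoset (suc k) _ _ _ _) q = ≤-refl

_Refines_ : (d c : Fin m → ℕ) → Set
d Refines c = ∀ {i j} → d i ≡ d j → c i ≡ c j

≗⇒Refines : {c d : Fin m → ℕ} → c ≗ d → c Refines d
≗⇒Refines c≗d {i} {j} ci≡cj = trans (sym (c≗d i)) (trans ci≡cj (c≗d j))

proper? : {R : Rel (Fin m) 0ℓ} → Decidable R → ∀ c → Dec (Proper R c)
proper? R? c = all? λ i → all? λ j → ¬? (i ≟Fin j) →-dec R? i j →-dec ¬? (c i ≟ℕ c j)

proper-cong : {R S : Rel (Fin m) 0ℓ} {c : Fin m → ℕ} → S ⇒ R → Proper R c → Proper S c
proper-cong S⇒R proper i j i≢j = proper i j i≢j ∘ S⇒R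

proper-refines : {R : Rel (Fin m) 0ℓ} {c d : Fin m → ℕ} →
                 d Refines c → Proper R c → Proper R d
proper-refines d⊑c proper i j i≢j Rij = proper i j i≢j Rij ∘ d⊑c

proper-isCopy : ∀ {Q} {R : Rel (Fin m) 0ℓ} {c h} →
                IsCopy Q R h → Proper R c → Proper (Le Q) (c ∘ h)
proper-isCopy (h-inj , h-iso) proper i j i≢j i≤j =
  proper _ _ (i≢j ∘ h-inj) (to (h-iso i j) i≤j)

module Compression (c : Fin k → ℕ) where

  private
    pick : ∀ v → ∃ (λ j → c j ≡ v) → Fin k
    pick v e with any? (λ j → c j ≟ℕ v)
    ... | yes (j , _) = j
    ... | no ∄ = ⊥-elim (∄ e)

    pick-colour : ∀ v e → c (pick v e) ≡ v
    pick-colour v e with any? (λ j → c j ≟ℕ v)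
    ... | yes (_ , cj≡v) = cj≡v
    ... | no ∄ = ⊥-elim (∄ e)

    pick-cong : ∀ {v w} → v ≡ w → ∀ e e′ → pick v e ≡ pick w e′
    pick-cong {v} refl e e′ with any? (λ j → c j ≟ℕ v)
    ... | yes _ = refl
    ... | no ∄ = ⊥-elim (∄ e)

  compress : Fin k → Fin k
  compress i = pick (c i) (i , refl)

  compress-refines : (toℕ ∘ compress) Refines c
  compress-refines {i} {j} eq = trans (sym (pick-colour _ (i , refl)))
    (trans (cong c (toℕ-injective eq)) (pick-colour _ (j , refl)))

  refines-compress : c Refines (toℕ ∘ compress)
  refines-compress eq = cong toℕ (pick-cong eq _ _)

RainbowAvoiding : FinPoset → (R : Rel (Fin m) 0ℓ) → (Fin m → ℕ) → Set
RainbowAvoiding P R c = Proper R c × ¬ HasRainbowCopy P R c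

RainbowForcing : FinPoset → (R : Rel (Fin m) 0ℓ) → Set
RainbowForcing P R = ∀ c → Proper R c → HasRainbowCopy P R c

module _ (P : FinPoset) {R : Rel (Fin m) 0ℓ} where

  hasRainbowCopy? : Decidable R → ∀ c → Dec (HasRainbowCopy P R c)
  hasRainbowCopy? R? c =
    any?-function (λ g → isCopy? P {g = g} R? ×-dec injective? _≟ℕ_ (c ∘ g))
      λ g≗h (copy , rainbow) →
        isCopy-resp-≗ P {R = R} g≗h copy , injective-resp-≗ (cong c ∘ g≗h) rainbow

  rainbow-refines : ∀ {c d} → d Refines c → HasRainbowCopy P R c → HasRainbowCopy P R d
  rainbow-refines d⊑c (g , copy , rainbow) = g , copy , rainbow ∘ d⊑c

  avoiding-refines : ∀ {c d} → d Refines c → c Refines d →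
                     RainbowAvoiding P R c → RainbowAvoiding P R d
  avoiding-refines {c} {d} d⊑c c⊑d (proper , ¬rainbow) =
    proper-refines {R = R} d⊑c proper , ¬rainbow ∘ rainbow-refines {c = d} {d = c} c⊑d

  avoiding-cong : ∀ {S c} → R ⇒ S → S ⇒ R → RainbowAvoiding P R c → RainbowAvoiding P S c
  avoiding-cong {S} R⇒S S⇒R (proper , ¬rainbow) =
    proper-cong {R = R} S⇒R proper ,
    λ (g , copy , rainbow) →
      ¬rainbow (g , isCopy-cong P {R = S} {S = R} S⇒R R⇒S copy , rainbow)

  rainbowAvoiding? : Decidable R → ∀ c → Dec (RainbowAvoiding P R c)
  rainbowAvoiding? R? c = proper? R? c ×-dec ¬? (hasRainbowCopy? R? c)

  ∃-rainbowAvoiding? : Decidable R → Dec (∃ (RainbowAvoiding P R))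
  ∃-rainbowAvoiding? R? = map′
    (λ (d , avoiding) → toℕ ∘ d , avoiding)
    (λ (c , avoiding) →
      compress c , avoiding-refines (compress-refines c) (refines-compress c) avoiding)
    (any?-function (λ d → rainbowAvoiding? R? (toℕ ∘ d))
      λ d≗e →
        avoiding-refines (≗⇒Refines (sym ∘ cong toℕ ∘ d≗e)) (≗⇒Refines (cong toℕ ∘ d≗e)))
    where open Compression

  ∄-rainbowAvoiding⇒rainbowForcing : Decidable R → ¬ ∃ (RainbowAvoiding P R) →
                                     RainbowForcing P R
  ∄-rainbowAvoiding⇒rainbowForcing R? ∄ c proper with hasRainbowCopy? R? c
  ... | yes rainbow = rainbow
  ... | no ¬rainbow = ⊥-elim (∄ (c , proper , ¬rainbow))

  rainbowForcing? : Decidable R → Dec (RainbowForcing P R)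
  rainbowForcing? R? = map′
    (∄-rainbowAvoiding⇒rainbowForcing R?)
    (λ forcing (c , proper , ¬rainbow) → ¬rainbow (forcing c proper))
    (¬? (∃-rainbowAvoiding? R?))

  hasCopy⇒rainbowForcing : ∀ {Q} → RainbowForces Q P → HasCopy Q R → RainbowForcing P R
  hasCopy⇒rainbowForcing {Q} forces (h , h-copy) c proper
    with forces (c ∘ h) (proper-isCopy {Q = Q} {R = R} h-copy proper)
  ... | g , g-copy , rainbow = h ∘ g , isCopy-∘ {P = P} {Q} {R} h-copy g-copy , rainbow

rainbowForces⇒InM-copy : ∀ P Q → RainbowForces Q P → ∃ λ Q′ → InM P Q′ × HasCopy Q′ (Le Q)
rainbowForces⇒InM-copy P Q = go Q (<-wellFounded (size Q))
  where
  go : ∀ Q → Acc _<_ (size Q) → RainbowForces Q P → ∃ λ Q′ → InM P Q′ × HasCopy Q′ (Le Q)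
  go Q (acc rs) forces with any? (λ q → rainbowForcing? P (Le? (delete Q q)))
  ... | no none = Q , (forces , λ q f → none (q , f)) , id , isCopy-id Q
  ... | yes (q , f) with go (delete Q q) (rs (size-delete Q q)) f | delete-hasCopy Q q
  ...   | Q′ , Q′∈M , g , g-copy | h , h-copy =
    Q′ , Q′∈M , h ∘ g , isCopy-∘ {P = Q′} {delete Q q} {Le Q} h-copy g-copy

⊆⇒T : {p q : Subset n} → p ⊆ q → T ⌊ p ⊆? q ⌋
⊆⇒T {p = p} {q} = fromWitness {a? = p ⊆? q}

T⇒⊆ : {p q : Subset n} → T ⌊ p ⊆? q ⌋ → p ⊆ q
T⇒⊆ {p = p} {q} = toWitness {a? = p ⊆? q}

inclusionPoset : Family n → FinPoset
inclusionPoset F = mkPoset (card F) (λ i j → ⌊ member F i ⊆? member F j ⌋)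
  (λ _ → ⊆⇒T ⊆-refl)
  (λ _ _ i⊆j j⊆i → distinct F (⊆-antisym (T⇒⊆ i⊆j) (T⇒⊆ j⊆i)))
  (λ _ _ _ i⊆j j⊆k → ⊆⇒T (⊆-trans (T⇒⊆ i⊆j) (T⇒⊆ j⊆k)))

Incl⇒Le : (F : Family n) → Incl F ⇒ Le (inclusionPoset F)
Incl⇒Le F {i} {j} = ⊆⇒T {p = member F i} {member F j}

Le⇒Incl : (F : Family n) → Le (inclusionPoset F) ⇒ Incl F
Le⇒Incl F {i} {j} = T⇒⊆ {p = member F i} {member F j}

module _ (P : FinPoset) (F : Family n) where

  rainbowFree⇒free : RainbowFree P F → Free (InM P) F
  rainbowFree⇒free (c , proper , ¬rainbow) Q (forces , _) copy =
    ¬rainbow (hasCopy⇒rainbowForcing P {R = Incl F} {Q} forces copy c proper)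

  free⇒rainbowFree : Free (InM P) F → RainbowFree P F
  free⇒rainbowFree free with ∃-rainbowAvoiding? P (Le? (inclusionPoset F))
  ... | yes (c , avoiding) = c , avoiding-cong P (Le⇒Incl F) (Incl⇒Le F) avoiding
  ... | no ∄ with rainbowForces⇒InM-copy P (inclusionPoset F)
                    (∄-rainbowAvoiding⇒rainbowForcing P (Le? (inclusionPoset F)) ∄)
  ...   | Q , Q∈M , g , g-copy = ⊥-elim (free Q Q∈M (g , copy))
    where
    copy : IsCopy Q (Incl F) g
    copy = isCopy-cong Q {R = Le (inclusionPoset F)} (Le⇒Incl F) (Incl⇒Le F) g-copy

isMaxSize-cong : {G H : Family n → Set} → (∀ F → G F → H F) → (∀ F → H F → G F) →
                 IsMaxSize n G m → IsMaxSize n H m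
isMaxSize-cong G⇒H H⇒G ((F , good , size≡m) , maximal) =
  (F , G⇒H F good , size≡m) , λ F′ → maximal F′ ∘ H⇒G F′

proposition1p3 : ∀ (P : FinPoset) (n m : ℕ) → (IsLaR n P m ⇔ IsLa n (InM P) m)
proposition1p3 P n m = mk⇔
  (isMaxSize-cong (rainbowFree⇒free P) (free⇒rainbowFree P))
  (isMaxSize-cong (free⇒rainbowFree P) (rainbowFree⇒free P))
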